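{- Let $k\ge 2$ and let $H$ be the full-$k$-star with vertex set $\{0\}\cup[n]$ and center $0$. Let $G_1,\dots,G_t$ be subhypergraphs of $H$ (i.e. subsets of its edge set), and let $F_1,\dots,F_t$ be $k$-uniform hypergraphs on the vertex set $[n]$. Suppose that (i) for every $i=1,\dots,t$, the hypergraph $H_i:=(H\setminus G_i)\cup F_i$ is tight-cycle-free, and (ii) $\partial_{k-1}(F_i)\cap\partial_{k-1}(F_j)=\emptyset$ for all $1\le i<j\le t$. Then the hypergraph $$H' := \Big(H\setminus \bigcup_{i=1}^t G_i\Big)\cup\Big(\bigcup_{i=1}^t F_i\Big)$$ is tight-cycle-free.
   Context: $[n]=\{1,\dots,n\}$. The full-$k$-star on vertex set $V$ with center $x\in V$ is the $k$-uniform hypergraph whose edges are all $k$-subsets of $V$ containing $x$. For hypergraphs on a common vertex set, $\setminus$ and $\cup$ refer to the edge sets. For a hypergraph $F$, its $(k-1)$-shadow is $\partial_{k-1}(F)=\{S: |S|=k-1,\ S\subseteq e \text{ for some edge } e \text{ of } F\}$. For $\ell\ge k+1$, the tight cycle $TC_\ell^k$ is the $k$-uniform hypergraph on $\ell$ distinct vertices $v_0,\dots,v_{\ell-1}$ with edges $\{v_i,\dots,v_{i+k-1}\}$ (subscripts mod $\ell$); a $k$-uniform hypergraph is tight-cycle-free if it contains no subhypergraph isomorphic to $TC_\ell^k$ for any $\ell\ge k+1$. -}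

module Defs where

open import Data.Nat using (ℕ; zero; suc; _+_; _∸_; _≤_)
open import Data.Nat.DivMod using (_mod_)
open import Data.Fin using (Fin; toℕ) renaming (zero to fzero)
open import Data.Fin.Subset using (Subset; _∈_; _∉_; _⊆_; ∣_∣)
open import Data.Product using (Σ; ∃; _×_)
open import Data.Sum using (_⊎_)
open import Relation.Nullary using (¬_)
open import Relation.Binary.PropositionalEquality using (_≡_)
open import Function.Definitions using (Injective)
open import Function.Bundles using (_⇔_)

-- Vertex set {0} ∪ [n] is Fin (suc n): vertex 0 is fzero, vertex i ∈ [n] is suc (i-1).
-- A hypergraph on this vertex set is given by its edge set, a predicate on
-- subsets of the vertex set.
Hyp : ℕ → Set₁
Hyp n = Subset (suc n) → Set

FullStar : (n k : ℕ) → Hyp n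
FullStar n k e = ∣ e ∣ ≡ k × fzero ∈ e

_∖_ : ∀ {n} → Hyp n → Hyp n → Hyp n
(A ∖ B) e = A e × ¬ B e

_∪_ : ∀ {n} → Hyp n → Hyp n → Hyp n
(A ∪ B) e = A e ⊎ B e

⋃ : ∀ {n t} → (Fin t → Hyp n) → Hyp n
⋃ {t = t} A e = Σ (Fin t) λ i → A i e

_⊑_ : ∀ {n} → Hyp n → Hyp n → Set
A ⊑ B = ∀ e → A e → B e

-- k-uniform hypergraph on vertex set [n] (i.e. avoiding vertex 0)
UniformOnN : (n k : ℕ) → Hyp n → Set
UniformOnN n k F = ∀ e → F e → ∣ e ∣ ≡ k × fzero ∉ e

Shadow : ∀ {n} → ℕ → Hyp n → Hyp n
Shadow k F S = ∣ S ∣ ≡ k ∸ 1 × Σ _ λ e → F e × S ⊆ e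

-- E contains a copy of the tight cycle TC_ℓ^k with ℓ = suc m ≥ k+1:
-- distinct vertices v_0,…,v_m such that every {v_i,…,v_{i+k-1}} (indices mod ℓ)
-- is an edge of E.
ContainsTightCycle : ∀ {n} → ℕ → Hyp n → Set
ContainsTightCycle {n} k E =
  Σ ℕ λ m → (suc k ≤ suc m) ×
  Σ (Fin (suc m) → Fin (suc n)) λ v → Injective _≡_ _≡_ v ×
  (∀ (i : Fin (suc m)) → Σ (Subset (suc n)) λ e → E e ×
     (∀ x → (x ∈ e) ⇔ (Σ (Fin k) λ j → x ≡ v ((toℕ i + toℕ j) mod (suc m)))))

TightCycleFree : ∀ {n} → ℕ → Hyp n → Set
TightCycleFree k E = ¬ ContainsTightCycle k E

-- Let H′ = (H ∖ ⋃ Gᵢ) ∪ ⋃ Fᵢ and suppose H′ contains a tight cycle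
-- v₀ … v_m with edges eᵢ = {vᵢ, …, v_{i+k-1}}.  Two consecutive edges of a
-- tight cycle share the k-1 vertices e_x ∖ {v_x}.  Hence, if both are edges
-- of the family (Fᵢ), they lie in the SAME Fₐ, since the shadows of
-- different Fᵢ are disjoint.  Edges of H′ through the centre 0 are star
-- edges outside every Gᵢ; the remaining edges come from ⋃ Fᵢ.  The edges
-- avoiding 0 form one run of consecutive edges of the cycle: all edges if 0
-- is not on the cycle, and the ℓ-k edges starting right after 0 = v_P
-- otherwise.  Along this run the index a is constant, so every edge of the
-- cycle is an edge of Hₐ = (H ∖ Gₐ) ∪ Fₐ, contradicting hypothesis (i).

module Submission where

open import Defs
open import Data.Nat using (ℕ; zero; suc; _+_; _∸_; _≤_; _%_; z≤n; s≤s; s≤s⁻¹; pred)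
  renaming (_<_ to _<ℕ_)
import Data.Nat.Properties as ℕP
open import Data.Nat.DivMod
  using (_mod_; m%n<n; %-distribˡ-+; m%n%n≡m%n; m<n⇒m%n≡m; [m+n]%n≡m%n)
open import Data.Fin using (Fin; _<_; toℕ; fromℕ<) renaming (zero to fzero; suc to fsuc)
import Data.Fin.Properties as FinP
open import Data.Fin.Subset using (Subset; _∈_; _∉_; _⊆_; ∣_∣; _-_; inside; outside)
open import Data.Fin.Subset.Properties using (p─⊥≡p; p─q⊆p)
open import Data.Vec using (_∷_; here; there)
open import Data.Product using (Σ; _×_; _,_; proj₁; proj₂)
open import Data.Sum using (inj₁; inj₂)
open import Data.Empty using (⊥-elim)
open import Relation.Nullary using (¬_; yes; no)
open import Relation.Binary using (tri<; tri≈; tri>)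
open import Relation.Binary.PropositionalEquality
open import Function using (_∘_)
open import Function.Definitions using (Injective)
open import Function.Bundles using (_⇔_; Equivalence)

∣p-x∣+1≡∣p∣ : ∀ {n} {x : Fin n} {p : Subset n} → x ∈ p → suc ∣ p - x ∣ ≡ ∣ p ∣
∣p-x∣+1≡∣p∣ {x = fzero}  {inside ∷ p}  here        = cong (suc ∘ ∣_∣) (p─⊥≡p p)
∣p-x∣+1≡∣p∣ {x = fsuc x} {inside ∷ p}  (there x∈p) = cong suc (∣p-x∣+1≡∣p∣ x∈p)
∣p-x∣+1≡∣p∣ {x = fsuc x} {outside ∷ p} (there x∈p) = ∣p-x∣+1≡∣p∣ x∈p

x∉p-x : ∀ {n} {x : Fin n} {p : Subset n} → x ∉ p - x
x∉p-x {x = fzero}  {_ ∷ p} ()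
x∉p-x {x = fsuc x} {_ ∷ p} (there x∈p-x) = x∉p-x x∈p-x

module Residues (m : ℕ) where

  ℓ : ℕ
  ℓ = suc m

  toℕ-mod : ∀ a → toℕ (a mod ℓ) ≡ a % ℓ
  toℕ-mod a = FinP.toℕ-fromℕ< (m%n<n a ℓ)

  mod-cong : ∀ a b → a % ℓ ≡ b % ℓ → a mod ℓ ≡ b mod ℓ
  mod-cong a b eq = FinP.fromℕ<-cong (a % ℓ) (b % ℓ) eq (m%n<n a ℓ) (m%n<n b ℓ)

  mod-toℕ : ∀ (i : Fin ℓ) → toℕ i mod ℓ ≡ i
  mod-toℕ i = FinP.toℕ-injective (trans (toℕ-mod (toℕ i)) (m<n⇒m%n≡m (FinP.toℕ<n i)))

  %-absorbˡ : ∀ a j → (a % ℓ + j) % ℓ ≡ (a + j) % ℓ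
  %-absorbˡ a j = begin
    (a % ℓ + j) % ℓ         ≡⟨ %-distribˡ-+ (a % ℓ) j ℓ ⟩
    (a % ℓ % ℓ + j % ℓ) % ℓ ≡⟨ cong (λ r → (r + j % ℓ) % ℓ) (m%n%n≡m%n a ℓ) ⟩
    (a % ℓ + j % ℓ) % ℓ     ≡⟨ %-distribˡ-+ a j ℓ ⟨
    (a + j) % ℓ             ∎
    where open ≡-Reasoning

  %-absorbʳ : ∀ a j → (a + j % ℓ) % ℓ ≡ (a + j) % ℓ
  %-absorbʳ a j = begin
    (a + j % ℓ) % ℓ ≡⟨ cong (_% ℓ) (ℕP.+-comm a (j % ℓ)) ⟩
    (j % ℓ + a) % ℓ ≡⟨ %-absorbˡ j a ⟩
    (j + a) % ℓ     ≡⟨ cong (_% ℓ) (ℕP.+-comm j a) ⟩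
    (a + j) % ℓ     ∎
    where open ≡-Reasoning

  mod-absorbˡ : ∀ a j → (toℕ (a mod ℓ) + j) mod ℓ ≡ (a + j) mod ℓ
  mod-absorbˡ a j = mod-cong (toℕ (a mod ℓ) + j) (a + j)
    (trans (cong (λ r → (r + j) % ℓ) (toℕ-mod a)) (%-absorbˡ a j))

  mod-+ℓ : ∀ a → (a + ℓ) mod ℓ ≡ a mod ℓ
  mod-+ℓ a = mod-cong (a + ℓ) a ([m+n]%n≡m%n a ℓ)

  r≢[r+d]%ℓ : ∀ r d → r <ℕ ℓ → 0 <ℕ d → d <ℕ ℓ → r ≢ (r + d) % ℓ
  r≢[r+d]%ℓ r d r<ℓ 0<d d<ℓ eq with r + d ℕP.<? ℓ
  ... | yes r+d<ℓ = ℕP.<-irrefl (trans eq (m<n⇒m%n≡m r+d<ℓ)) r<r+d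
    where
    r<r+d : r <ℕ r + d
    r<r+d = subst (_≤ r + d) (ℕP.+-comm r 1) (ℕP.+-monoʳ-≤ r 0<d)
  ... | no r+d≮ℓ = ℕP.<-irrefl (sym (trans eq r+d%ℓ≡q)) q<r
    where
    q = r + d ∸ ℓ
    q+ℓ≡r+d : q + ℓ ≡ r + d
    q+ℓ≡r+d = ℕP.m∸n+n≡m (ℕP.≮⇒≥ r+d≮ℓ)
    q<r : q <ℕ r
    q<r = ℕP.+-cancelʳ-< ℓ q r (subst (_<ℕ r + ℓ) (sym q+ℓ≡r+d) (ℕP.+-monoʳ-< r d<ℓ))
    r+d%ℓ≡q : (r + d) % ℓ ≡ q
    r+d%ℓ≡q = trans (cong (_% ℓ) (sym q+ℓ≡r+d))
                (trans ([m+n]%n≡m%n q ℓ) (m<n⇒m%n≡m (ℕP.<-trans q<r r<ℓ)))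

  shift-moves : ∀ a d → 0 <ℕ d → d <ℕ ℓ → a mod ℓ ≢ (a + d) mod ℓ
  shift-moves a d 0<d d<ℓ eq = r≢[r+d]%ℓ (a % ℓ) d (m%n<n a ℓ) 0<d d<ℓ (begin
    a % ℓ               ≡⟨ toℕ-mod a ⟨
    toℕ (a mod ℓ)       ≡⟨ cong toℕ eq ⟩
    toℕ ((a + d) mod ℓ) ≡⟨ toℕ-mod (a + d) ⟩
    (a + d) % ℓ         ≡⟨ %-absorbˡ a d ⟨
    (a % ℓ + d) % ℓ     ∎)
    where open ≡-Reasoning

  residue-reached : ∀ b (i : Fin ℓ) → Σ ℕ λ s → s ≤ m × (b + s) mod ℓ ≡ i
  residue-reached b i = c % ℓ , s≤s⁻¹ (m%n<n c ℓ) , trans (mod-cong (b + c % ℓ) (toℕ i) b+s≡i) (mod-toℕ i)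
    where
    c = toℕ i + ℓ ∸ b % ℓ
    b%ℓ+c≡i+ℓ : b % ℓ + c ≡ toℕ i + ℓ
    b%ℓ+c≡i+ℓ = ℕP.m+[n∸m]≡n (ℕP.≤-trans (ℕP.<⇒≤ (m%n<n b ℓ)) (ℕP.m≤n+m ℓ (toℕ i)))
    open ≡-Reasoning
    b+s≡i : (b + c % ℓ) % ℓ ≡ toℕ i % ℓ
    b+s≡i = begin
      (b + c % ℓ) % ℓ   ≡⟨ %-absorbʳ b c ⟩
      (b + c) % ℓ       ≡⟨ %-absorbˡ b c ⟨
      (b % ℓ + c) % ℓ   ≡⟨ cong (_% ℓ) b%ℓ+c≡i+ℓ ⟩
      (toℕ i + ℓ) % ℓ   ≡⟨ [m+n]%n≡m%n (toℕ i) ℓ ⟩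
      toℕ i % ℓ         ∎

module TightWalk {n : ℕ} (k m : ℕ)
    (v : Fin (suc m) → Fin (suc n))
    (edge : Fin (suc m) → Subset (suc n))
    (spans : ∀ i x → (x ∈ edge i) ⇔ (Σ (Fin k) λ j → x ≡ v ((toℕ i + toℕ j) mod suc m)))
  where

  open Residues m

  W : ℕ → Fin (suc n)
  W a = v (a mod ℓ)

  E : ℕ → Subset (suc n)
  E a = edge (a mod ℓ)

  E-to : ∀ a {y} → y ∈ E a → Σ (Fin k) λ j → y ≡ W (a + toℕ j)
  E-to a {y} y∈E with Equivalence.to (spans (a mod ℓ) y) y∈E
  ... | j , y≡ = j , trans y≡ (cong v (mod-absorbˡ a (toℕ j)))

  E-from : ∀ a j → j <ℕ k → W (a + j) ∈ E a
  E-from a j j<k = Equivalence.from (spans (a mod ℓ) (W (a + j)))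
    (fromℕ< j<k , cong v (begin
      (a + j) mod ℓ                               ≡⟨ mod-absorbˡ a j ⟨
      (toℕ (a mod ℓ) + j) mod ℓ                   ≡⟨ cong (λ j′ → (toℕ (a mod ℓ) + j′) mod ℓ)
                                                        (FinP.toℕ-fromℕ< j<k) ⟨
      (toℕ (a mod ℓ) + toℕ (fromℕ< j<k)) mod ℓ   ∎))
    where open ≡-Reasoning

  W-in-E : 0 <ℕ k → ∀ a → W a ∈ E a
  W-in-E 0<k a = subst (_∈ E a) (cong W (ℕP.+-identityʳ a)) (E-from a 0 0<k)

  E-overlap : ∀ a → E a - W a ⊆ E (suc a)
  E-overlap a {y} y∈ with E-to a (p─q⊆p (E a) _ y∈)
  ... | j , y≡ = shifted (toℕ j) (FinP.toℕ<n j) y≡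
    where
    shifted : ∀ j → j <ℕ k → y ≡ W (a + j) → y ∈ E (suc a)
    shifted zero    _     y≡ = ⊥-elim (x∉p-x (subst (_∈ E a - W a)
                                 (trans y≡ (cong W (ℕP.+-identityʳ a))) y∈))
    shifted (suc j) 1+j<k y≡ = subst (_∈ E (suc a))
      (sym (trans y≡ (cong W (ℕP.+-suc a j)))) (E-from (suc a) j (ℕP.<-trans (ℕP.n<1+n j) 1+j<k))

  W-apart : Injective _≡_ _≡_ v → ∀ a d → 0 <ℕ d → d <ℕ ℓ → W a ≢ W (a + d)
  W-apart inj a d 0<d d<ℓ = shift-moves a d 0<d d<ℓ ∘ inj

shared-shadow⇒same-index : ∀ {n k t} (F : Fin t → Hyp n) →
  (∀ i j → i < j → ∀ S → ¬ (Shadow k (F i) S × Shadow k (F j) S)) →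
  ∀ {c c′ e e′} S → ∣ S ∣ ≡ k ∸ 1 → F c e → F c′ e′ → S ⊆ e → S ⊆ e′ → c ≡ c′
shared-shadow⇒same-index F disjoint {c} {c′} {e} {e′} S ∣S∣ Fe Fe′ S⊆e S⊆e′
  with FinP.<-cmp c c′
... | tri< c<c′ _ _ = ⊥-elim (disjoint c c′ c<c′ S ((∣S∣ , e , Fe , S⊆e) , (∣S∣ , e′ , Fe′ , S⊆e′)))
... | tri≈ _ c≡c′ _ = c≡c′
... | tri> _ _ c′<c = ⊥-elim (disjoint c′ c c′<c S ((∣S∣ , e′ , Fe′ , S⊆e′) , (∣S∣ , e , Fe , S⊆e)))

module Gluing (k n t : ℕ) (2≤k : 2 ≤ k) (G F : Fin t → Hyp n)
    (uniform : ∀ i → UniformOnN n k (F i))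
    (disjoint : ∀ i j → i < j → ∀ S → ¬ (Shadow k (F i) S × Shadow k (F j) S))
  where

  H′ : Hyp n
  H′ = (FullStar n k ∖ ⋃ G) ∪ ⋃ F

  Hᵢ : Fin t → Hyp n
  Hᵢ i = (FullStar n k ∖ G i) ∪ F i

  avoiding-centre⇒in-family : ∀ {e} → H′ e → fzero ∉ e → Σ (Fin t) λ c → F c e
  avoiding-centre⇒in-family (inj₁ ((_ , 0∈e) , _)) 0∉e = ⊥-elim (0∉e 0∈e)
  avoiding-centre⇒in-family (inj₂ Fe)               _   = Fe

  H′⇒Hᵢ : ∀ a {e} → H′ e → (fzero ∉ e → F a e) → Hᵢ a e
  H′⇒Hᵢ a (inj₁ (star , ∉⋃G)) _   = inj₁ (star , λ Gae → ∉⋃G (a , Gae))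
  H′⇒Hᵢ a (inj₂ (c , Fce))    inFa = inj₂ (inFa (proj₂ (uniform c _ Fce)))

  module OnCycle (m : ℕ) (k≤m : suc k ≤ suc m)
      (v : Fin (suc m) → Fin (suc n)) (inj : Injective _≡_ _≡_ v)
      (edge : Fin (suc m) → Subset (suc n))
      (inH′ : ∀ i → H′ (edge i))
      (spans : ∀ i x → (x ∈ edge i) ⇔ (Σ (Fin k) λ j → x ≡ v ((toℕ i + toℕ j) mod suc m)))
    where

    open Residues m
    open TightWalk k m v edge spans

    0<k : 0 <ℕ k
    0<k = ℕP.<-≤-trans (s≤s z≤n) 2≤k

    consecutive-same-index : ∀ a {c c′} → F c (E a) → F c′ (E (suc a)) → c ≡ c′
    consecutive-same-index a {c} FcEa Fc′Ea+1 =
      shared-shadow⇒same-index {k = k} F disjoint (E a - W a) ∣S∣ FcEa Fc′Ea+1 (p─q⊆p (E a) _) (E-overlap a)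
      where
      ∣S∣ : ∣ E a - W a ∣ ≡ k ∸ 1
      ∣S∣ = cong pred (trans (∣p-x∣+1≡∣p∣ (W-in-E 0<k a)) (proj₁ (uniform c (E a) FcEa)))

    run-same-index : ∀ b N → (∀ s → s ≤ N → Σ (Fin t) λ c → F c (E (b + s))) →
      Σ (Fin t) λ a → ∀ s → s ≤ N → F a (E (b + s))
    run-same-index b N inFamily = a , along
      where
      a = proj₁ (inFamily 0 z≤n)
      along : ∀ s → s ≤ N → F a (E (b + s))
      along zero    _      = proj₂ (inFamily 0 z≤n)
      along (suc s) 1+s≤N with inFamily (suc s) 1+s≤N
      ... | c , FcE = subst (λ c → F c (E (b + suc s))) (sym a≡c) FcE
        where
        a≡c : a ≡ c
        a≡c = consecutive-same-index (b + s) (along s (ℕP.≤-trans (ℕP.n≤1+n s) 1+s≤N))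
                (subst (F c ∘ E) (ℕP.+-suc b s) FcE)

    CoveringRun : ℕ → ℕ → Set
    CoveringRun b N = (∀ s → s ≤ N → fzero ∉ E (b + s))
                    × (∀ i → fzero ∉ edge i → Σ ℕ λ s → s ≤ N × (b + s) mod ℓ ≡ i)

    covering-run⇒cycle-in-Hᵢ : ∀ b N → CoveringRun b N → Σ (Fin t) λ a → ContainsTightCycle k (Hᵢ a)
    covering-run⇒cycle-in-Hᵢ b N (avoid , cover) =
      a , (m , k≤m , v , inj , λ i → edge i , H′⇒Hᵢ a (inH′ i) (inFa i) , spans i)
      where
      run = run-same-index b N (λ s s≤N → avoiding-centre⇒in-family (inH′ _) (avoid s s≤N))
      a = proj₁ run
      inFa : ∀ i → fzero ∉ edge i → F a (edge i)
      inFa i 0∉ with cover i 0∉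
      ... | s , s≤N , b+s≡i = subst (F a ∘ edge) b+s≡i (proj₂ run s s≤N)

    covering-run-without-centre : (¬ Σ (Fin ℓ) λ p → v p ≡ fzero) → CoveringRun 0 m
    covering-run-without-centre 0∉cycle = avoid , λ i _ → toℕ i , FinP.toℕ≤pred[n] i , mod-toℕ i
      where
      avoid : ∀ s → s ≤ m → fzero ∉ E s
      avoid s _ 0∈E with E-to s 0∈E
      ... | j , 0≡W = 0∉cycle (_ , sym 0≡W)

    k≤m′ : k ≤ m
    k≤m′ = s≤s⁻¹ k≤m

    -- If W P = 0, the ℓ-k edges starting at P+1 avoid 0: their vertices are
    -- the W (P+d) with 1 ≤ d ≤ m, all different from W P.
    early-edges-avoid-centre : ∀ P → W P ≡ fzero → ∀ s → s ≤ m ∸ k → fzero ∉ E (suc P + s)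
    early-edges-avoid-centre P WP≡0 s s≤m-k 0∈E with E-to (suc P + s) 0∈E
    ... | j , 0≡W = W-apart inj P (suc (s + toℕ j)) (s≤s z≤n) (s≤s s+j<m)
      (trans WP≡0 (trans 0≡W (cong W (trans (cong suc (ℕP.+-assoc P s (toℕ j)))
                                          (sym (ℕP.+-suc P (s + toℕ j)))))))
      where
      s+j<m : s + toℕ j <ℕ m
      s+j<m = subst (s + toℕ j <ℕ_) (ℕP.m∸n+n≡m k≤m′) (ℕP.+-mono-≤-< s≤m-k (FinP.toℕ<n j))

    -- If W P = 0, every later edge starting at P+1+s (s ≤ m) reaches
    -- W (P+ℓ) = W P = 0.
    late-edges-meet-centre : ∀ P → W P ≡ fzero → ∀ s → s ≤ m → ¬ (s ≤ m ∸ k) → fzero ∈ E (suc P + s)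
    late-edges-meet-centre P WP≡0 s s≤m s≰m-k =
      subst (_∈ E (suc P + s)) W≡0 (E-from (suc P + s) (m ∸ s) m-s<k)
      where
      m-s<k : m ∸ s <ℕ k
      m-s<k = ℕP.+-cancelˡ-< s (m ∸ s) k (subst (_<ℕ s + k) (sym (ℕP.m+[n∸m]≡n s≤m))
                (subst (_<ℕ s + k) (ℕP.m∸n+n≡m k≤m′) (ℕP.+-monoˡ-< k (ℕP.≰⇒> s≰m-k))))
      W≡0 : W (suc P + s + (m ∸ s)) ≡ fzero
      W≡0 = trans (cong W (trans (ℕP.+-assoc (suc P) s (m ∸ s))
              (trans (cong (suc P +_) (ℕP.m+[n∸m]≡n s≤m)) (sym (ℕP.+-suc P m)))))
              (trans (cong v (mod-+ℓ P)) WP≡0)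

    covering-run-through-centre : ∀ p → v p ≡ fzero → CoveringRun (suc (toℕ p)) (m ∸ k)
    covering-run-through-centre p vp≡0 = early-edges-avoid-centre P WP≡0 , cover
      where
      P = toℕ p
      WP≡0 : W P ≡ fzero
      WP≡0 = trans (cong v (mod-toℕ p)) vp≡0
      cover : ∀ i → fzero ∉ edge i → Σ ℕ λ s → s ≤ m ∸ k × (suc P + s) mod ℓ ≡ i
      cover i 0∉ with residue-reached (suc P) i
      ... | s , s≤m , P+1+s≡i with s ℕP.≤? m ∸ k
      ... | yes s≤m-k = s , s≤m-k , P+1+s≡i
      ... | no  s≰m-k = ⊥-elim (0∉ (subst (λ i → fzero ∈ edge i) P+1+s≡i
                                      (late-edges-meet-centre P WP≡0 s s≤m s≰m-k)))

    covering-run : Σ ℕ λ b → Σ ℕ λ N → CoveringRun b N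
    covering-run with FinP.any? (λ p → v p FinP.≟ fzero)
    ... | yes (p , vp≡0) = suc (toℕ p) , m ∸ k , covering-run-through-centre p vp≡0
    ... | no  0∉cycle    = 0 , m , covering-run-without-centre 0∉cycle

    cycle-in-some-Hᵢ : Σ (Fin t) λ a → ContainsTightCycle k (Hᵢ a)
    cycle-in-some-Hᵢ with covering-run
    ... | b , N , run = covering-run⇒cycle-in-Hᵢ b N run

lemma3p1 : (k n t : ℕ) → 2 ≤ k →
    (G F : Fin t → Hyp n) →
    (∀ i → G i ⊑ FullStar n k) →
    (∀ i → UniformOnN n k (F i)) →
    (∀ i → TightCycleFree k ((FullStar n k ∖ G i) ∪ F i)) →
    (∀ i j → i < j → ∀ S → ¬ (Shadow k (F i) S × Shadow k (F j) S)) →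
    TightCycleFree k ((FullStar n k ∖ ⋃ G) ∪ ⋃ F)
lemma3p1 k n t 2≤k G F _ uniform Hᵢ-free disjoint (m , k≤m , v , inj , cycle) =
  Hᵢ-free (proj₁ cycle-in-some-Hᵢ) (proj₂ cycle-in-some-Hᵢ)
  where
  open Gluing k n t 2≤k G F uniform disjoint
  open OnCycle m k≤m v inj (proj₁ ∘ cycle) (proj₁ ∘ proj₂ ∘ cycle) (proj₂ ∘ proj₂ ∘ cycle)
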